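{- For all positive integers $n$, $M_{n+1,132}-M_{n,132}\le \dfrac{5n^2}{16}$.
   Context: For $p\in S_n$, $c_{132}(p)$ is the number of subsequences $p_ip_jp_k$ ($i<j<k$) with $p_i<p_k<p_j$, and $M_{n,132}=\max_{p\in S_n}c_{132}(p)$. -}

module Defs where

open import Data.Nat using (ℕ; _≤_)
open import Data.Fin using (Fin; _<_; _<?_)
open import Data.Fin.Permutation using (Permutation′; _⟨$⟩ʳ_)
open import Data.List using (List; length; filter; allFin; concatMap; map)
open import Relation.Binary.PropositionalEquality using (_≡_)
open import Data.Product using (_×_; _,_; ∃)
open import Relation.Nullary.Decidable using (_×-dec_)

triples : (n : ℕ) → List (Fin n × Fin n × Fin n)
triples n = concatMap (λ i → concatMap (λ j → map (λ k → (i , j , k)) (allFin n)) (allFin n)) (allFin n)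

c132 : {n : ℕ} → Permutation′ n → ℕ
c132 {n} p = length (filter dec (triples n))
  where
    dec : (t : Fin n × Fin n × Fin n) → _
    dec (i , j , k) =
      (i <? j) ×-dec ((j <? k) ×-dec (((p ⟨$⟩ʳ i) <? (p ⟨$⟩ʳ k)) ×-dec ((p ⟨$⟩ʳ k) <? (p ⟨$⟩ʳ j))))

IsM132 : ℕ → ℕ → Set
IsM132 n m = (∃ λ (p : Permutation′ n) → c132 p ≡ m) × (∀ (p : Permutation′ n) → c132 p ≤ m)

{-# OPTIONS --safe #-}
module Submission where

-- Let i be the position of the largest value n + 1 of π ∈ S_{n+1}, and π′ ∈ S_n the
-- pattern of π with position i deleted. The largest value can only play the role of
-- the 3 in a 132-occurrence, so c₁₃₂(π) = c₁₃₂(π′) + #{(x , z) | x < i < z, π x < π z}.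
-- The second term is at most (#positions left of i) · (#positions right of i) ≤ n²/4,
-- hence M_{n+1} − M_n ≤ n²/4, which is sharper than 5n²/16 and needs no n ≥ 1.

open import Defs
open import Data.Nat using (ℕ; zero; suc; _+_; _*_; _^_; _≤_; z≤n)
open import Data.Nat.Properties
  using ( +-*-semiring; ≤-refl; ≤-antisym; ≤-reflexive; ≤-total; +-mono-≤; +-monoˡ-≤; +-monoʳ-≤
        ; ≤-trans; *-mono-≤; *-monoʳ-≤; *-distribˡ-+; *-assoc; *-identityʳ; *-comm; +-comm; m≤m+n
        ; m≤n⇒∃[o]m+o≡n; <⇒≱; ≰⇒>; module ≤-Reasoning)
open import Data.Nat.Tactic.RingSolver using (solve-∀)
open import Data.Bool using (true; false)
open import Data.Fin using (Fin; zero; suc; fromℕ; punchIn; _<_; _<?_)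
open import Data.Fin.Properties using (≤fromℕ; <-irrefl; <-asym; punchIn-mono-≤; punchIn-cancel-≤)
open import Data.Fin.Permutation
  using (Permutation′; _⟨$⟩ʳ_; _⟨$⟩ˡ_; remove; inverseʳ; punchIn-permute)
open import Data.List using (List; _++_; length; filter; concatMap; map; tabulate; allFin)
open import Data.List.Properties using (length-++; filter-++)
open import Data.Product using (_×_; _,_)
open import Data.Product.Function.NonDependent.Propositional using (_×-⇔_)
open import Data.Sum using ([_,_]′)
open import Data.Empty using (⊥)
open import Function using (_∘_; id; _⇔_; mk⇔; Equivalence)
open import Level using (0ℓ)
open import Relation.Nullary using (Dec; yes; no; _because_; ¬_; contradiction)
open import Relation.Nullary.Decidable using (_×-dec_)
open import Relation.Unary using (Pred; Decidable)
open import Relation.Binary.PropositionalEquality using (_≡_; refl; sym; trans; cong; subst₂; cong₂; subst; module ≡-Reasoning)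
open import Algebra.Properties.Semiring.Sum +-*-semiring
  using (sum; sum-syntax; sum-remove; ∑-distrib-+; sum-cong-≗; sum-replicate-zero; *-distribˡ-sum; *-distribʳ-sum)

private variable
  P Q : Set
  n : ℕ

𝟙 : Dec P → ℕ
𝟙 (true  because _) = 1
𝟙 (false because _) = 0

𝟙-reject : ¬ P → (P? : Dec P) → 𝟙 P? ≡ 0
𝟙-reject ¬p (yes p) = contradiction p ¬p
𝟙-reject ¬p (no _)  = refl

𝟙-mono : (P → Q) → (P? : Dec P) (Q? : Dec Q) → 𝟙 P? ≤ 𝟙 Q?
𝟙-mono P⇒Q (yes _) (yes _) = ≤-refl
𝟙-mono P⇒Q (yes p) (no ¬q) = contradiction (P⇒Q p) ¬q
𝟙-mono P⇒Q (no _)  _       = z≤n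

𝟙-cong : P ⇔ Q → (P? : Dec P) (Q? : Dec Q) → 𝟙 P? ≡ 𝟙 Q?
𝟙-cong P⇔Q P? Q? = ≤-antisym (𝟙-mono (Equivalence.to P⇔Q) P? Q?) (𝟙-mono (Equivalence.from P⇔Q) Q? P?)

𝟙-×-dec : (P? : Dec P) (Q? : Dec Q) → 𝟙 (P? ×-dec Q?) ≡ 𝟙 P? * 𝟙 Q?
𝟙-×-dec (yes _) (yes _) = refl
𝟙-×-dec (yes _) (no _)  = refl
𝟙-×-dec (no _)  _       = refl

𝟙-disjoint-≤1 : (P → Q → ⊥) → (P? : Dec P) (Q? : Dec Q) → 𝟙 P? + 𝟙 Q? ≤ 1
𝟙-disjoint-≤1 disjoint (yes p) (yes q) = contradiction q (disjoint p)
𝟙-disjoint-≤1 disjoint (yes _) (no _)  = ≤-refl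
𝟙-disjoint-≤1 disjoint (no _)  (yes _) = ≤-refl
𝟙-disjoint-≤1 disjoint (no _)  (no _)  = z≤n

module _ {A : Set} {P : Pred A 0ℓ} (P? : Decidable P) where

  length-filter-concatMap-tabulate : ∀ {B : Set} (f : B → List A) (g : Fin n → B) →
    length (filter P? (concatMap f (tabulate g))) ≡ ∑[ i < n ] length (filter P? (f (g i)))
  length-filter-concatMap-tabulate {n = zero}  f g = refl
  length-filter-concatMap-tabulate {n = suc n} f g = begin
    length (filter P? (f (g zero) ++ concatMap f (tabulate (g ∘ suc))))
      ≡⟨ cong length (filter-++ P? (f (g zero)) _) ⟩
    length (filter P? (f (g zero)) ++ filter P? (concatMap f (tabulate (g ∘ suc))))
      ≡⟨ length-++ (filter P? (f (g zero))) ⟩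
    length (filter P? (f (g zero))) + length (filter P? (concatMap f (tabulate (g ∘ suc))))
      ≡⟨ cong (length (filter P? (f (g zero))) +_) (length-filter-concatMap-tabulate f (g ∘ suc)) ⟩
    ∑[ i < suc n ] length (filter P? (f (g i))) ∎
    where open ≡-Reasoning

  length-filter-map-tabulate : ∀ {B : Set} (f : B → A) (g : Fin n → B) →
    length (filter P? (map f (tabulate g))) ≡ ∑[ i < n ] 𝟙 (P? (f (g i)))
  length-filter-map-tabulate {n = zero}  f g = refl
  length-filter-map-tabulate {n = suc n} f g with P? (f (g zero))
  ... | yes _ = cong suc (length-filter-map-tabulate f (g ∘ suc))
  ... | no  _ = length-filter-map-tabulate f (g ∘ suc)

∑-mono-≤ : {f g : Fin n → ℕ} → (∀ i → f i ≤ g i) → sum f ≤ sum g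
∑-mono-≤ {n = zero}  f≤g = z≤n
∑-mono-≤ {n = suc n} f≤g = +-mono-≤ (f≤g zero) (∑-mono-≤ (f≤g ∘ suc))

∑-≤1-bounded : {f : Fin n → ℕ} → (∀ i → f i ≤ 1) → sum f ≤ n
∑-≤1-bounded {n = zero}  f≤1 = z≤n
∑-≤1-bounded {n = suc n} f≤1 = +-mono-≤ (f≤1 zero) (∑-≤1-bounded (f≤1 ∘ suc))

∑-zero : {f : Fin n → ℕ} → (∀ i → f i ≡ 0) → sum f ≡ 0
∑-zero {n} f≡0 = trans (sum-cong-≗ f≡0) (sum-replicate-zero n)

sum-remove-zero : (i : Fin (suc n)) (f : Fin (suc n) → ℕ) → f i ≡ 0 →
  sum f ≡ ∑[ a < n ] f (punchIn i a)
sum-remove-zero {n} i f fi≡0 = trans (sum-remove {i = i} f) (cong (_+ ∑[ a < n ] f (punchIn i a)) fi≡0)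

sum-*-sum : ∀ {m} (f : Fin m → ℕ) (g : Fin n → ℕ) →
  sum f * sum g ≡ ∑[ x < m ] ∑[ z < n ] (f x * g z)
sum-*-sum f g = trans (*-distribʳ-sum (sum g) f) (sum-cong-≗ λ x → *-distribˡ-sum (f x) g)

∑³ : (Fin n → Fin n → Fin n → ℕ) → ℕ
∑³ {n} f = ∑[ x < n ] ∑[ y < n ] ∑[ z < n ] f x y z

∑³-remove : (i : Fin (suc n)) (f : Fin (suc n) → Fin (suc n) → Fin (suc n) → ℕ) →
  (∀ y z → f i y z ≡ 0) → (∀ x y → f x y i ≡ 0) →
  ∑³ f ≡ ∑[ x < suc n ] ∑[ z < suc n ] f x i z + ∑³ (λ a b c → f (punchIn i a) (punchIn i b) (punchIn i c))
∑³-remove {n} i f fi··≡0 f··i≡0 = begin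
  ∑³ f
    ≡⟨ sum-cong-≗ (λ x → sum-remove {i = i} (λ y → ∑[ z < suc n ] f x y z)) ⟩
  ∑[ x < suc n ] (middle x + rest x)
    ≡⟨ ∑-distrib-+ middle rest ⟩
  sum middle + sum rest
    ≡⟨ cong (sum middle +_) (sum-remove-zero i rest rest-i≡0) ⟩
  sum middle + ∑[ a < n ] rest (punchIn i a)
    ≡⟨ cong (sum middle +_) (sum-cong-≗ λ a → sum-cong-≗ λ b →
         sum-remove-zero i (f (punchIn i a) (punchIn i b)) (f··i≡0 (punchIn i a) (punchIn i b))) ⟩
  sum middle + ∑³ (λ a b c → f (punchIn i a) (punchIn i b) (punchIn i c)) ∎
  where
  open ≡-Reasoning
  middle rest : Fin (suc n) → ℕ
  middle x = ∑[ z < suc n ] f x i z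
  rest x = ∑[ b < n ] ∑[ z < suc n ] f x (punchIn i b) z
  rest-i≡0 : rest i ≡ 0
  rest-i≡0 = ∑-zero λ b → ∑-zero λ z → fi··≡0 (punchIn i b) z

∑-below+∑-above-≤ : (i : Fin (suc n)) → ∑[ x < suc n ] 𝟙 (x <? i) + ∑[ x < suc n ] 𝟙 (i <? x) ≤ n
∑-below+∑-above-≤ {n} i = begin
  ∑[ x < suc n ] 𝟙 (x <? i) + ∑[ x < suc n ] 𝟙 (i <? x)
    ≡⟨ sym (∑-distrib-+ below above) ⟩
  ∑[ x < suc n ] (below x + above x)
    ≡⟨ sum-remove-zero i (λ x → below x + above x) (cong₂ _+_ i≮i i≮i) ⟩
  ∑[ a < n ] (𝟙 (punchIn i a <? i) + 𝟙 (i <? punchIn i a))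
    ≤⟨ ∑-≤1-bounded (λ a → 𝟙-disjoint-≤1 <-asym (punchIn i a <? i) (i <? punchIn i a)) ⟩
  n ∎
  where
  open ≤-Reasoning
  below above : Fin (suc n) → ℕ
  below x = 𝟙 (x <? i)
  above x = 𝟙 (i <? x)
  i≮i : 𝟙 (i <? i) ≡ 0
  i≮i = 𝟙-reject (<-irrefl refl) (i <? i)

punchIn-<-⇔ : (i : Fin (suc n)) {j k : Fin n} → punchIn i j < punchIn i k ⇔ j < k
punchIn-<-⇔ i {j} {k} = mk⇔
  (λ ij<ik → ≰⇒> λ k≤j → <⇒≱ ij<ik (punchIn-mono-≤ i k j k≤j))
  (λ j<k → ≰⇒> λ ik≤ij → <⇒≱ j<k (punchIn-cancel-≤ i k j ik≤ij))

fromℕ-≮ : (z : Fin (suc n)) → ¬ fromℕ n < z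
fromℕ-≮ z fromℕ<z = <⇒≱ fromℕ<z (≤fromℕ z)

4[m*n]≤[m+n]*[m+n] : ∀ m n → 4 * (m * n) ≤ (m + n) * (m + n)
4[m*n]≤[m+n]*[m+n] m n = [ ordered , flipped ]′ (≤-total m n)
  where
  square-of-sum : ∀ m d → 4 * (m * (m + d)) + d * d ≡ (m + (m + d)) * (m + (m + d))
  square-of-sum = solve-∀
  ordered : ∀ {m n} → m ≤ n → 4 * (m * n) ≤ (m + n) * (m + n)
  ordered {m} m≤n with d , refl ← m≤n⇒∃[o]m+o≡n m≤n =
    ≤-trans (m≤m+n _ (d * d)) (≤-reflexive (square-of-sum m d))
  flipped : n ≤ m → 4 * (m * n) ≤ (m + n) * (m + n)
  flipped n≤m = subst₂ _≤_ (cong (4 *_) (*-comm n m)) (cong (λ s → s * s) (+-comm n m)) (ordered n≤m)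

Occ132 : Permutation′ n → Fin n → Fin n → Fin n → Set
Occ132 p x y z = x < y × y < z × (p ⟨$⟩ʳ x) < (p ⟨$⟩ʳ z) × (p ⟨$⟩ʳ z) < (p ⟨$⟩ʳ y)

occ132? : (p : Permutation′ n) (x y z : Fin n) → Dec (Occ132 p x y z)
occ132? p x y z =
  (x <? y) ×-dec ((y <? z) ×-dec (((p ⟨$⟩ʳ x) <? (p ⟨$⟩ʳ z)) ×-dec ((p ⟨$⟩ʳ z) <? (p ⟨$⟩ʳ y))))

c132≡∑³ : (p : Permutation′ n) → c132 p ≡ ∑³ (λ x y z → 𝟙 (occ132? p x y z))
c132≡∑³ {n} p =
  trans (length-filter-concatMap-tabulate P? plane id) (sum-cong-≗ λ x →
  trans (length-filter-concatMap-tabulate P? (line x) id) (sum-cong-≗ λ y →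
  length-filter-map-tabulate P? (λ z → x , y , z) id))
  where
  P? : Decidable λ ((x , y , z) : Fin n × Fin n × Fin n) → Occ132 p x y z
  P? (x , y , z) = occ132? p x y z
  line : Fin n → Fin n → List (Fin n × Fin n × Fin n)
  line x y = map (λ z → x , y , z) (allFin n)
  plane : Fin n → List (Fin n × Fin n × Fin n)
  plane x = concatMap (line x) (allFin n)

Occ132-punchIn-⇔ : (π : Permutation′ (suc n)) (i : Fin (suc n)) (a b c : Fin n) →
  Occ132 π (punchIn i a) (punchIn i b) (punchIn i c) ⇔ Occ132 (remove i π) a b c
Occ132-punchIn-⇔ π i a b c = punchIn-<-⇔ i ×-⇔ punchIn-<-⇔ i ×-⇔ values-⇔ a c ×-⇔ values-⇔ c b
  where
  values-⇔ : ∀ a c → (π ⟨$⟩ʳ punchIn i a) < (π ⟨$⟩ʳ punchIn i c) ⇔ (remove i π ⟨$⟩ʳ a) < (remove i π ⟨$⟩ʳ c)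
  values-⇔ a c = subst₂ (λ u v → u < v ⇔ (remove i π ⟨$⟩ʳ a) < (remove i π ⟨$⟩ʳ c))
    (sym (punchIn-permute π i a)) (sym (punchIn-permute π i c)) (punchIn-<-⇔ (π ⟨$⟩ʳ i))

c132-middle : Permutation′ n → Fin n → ℕ
c132-middle {n} p i = ∑[ x < n ] ∑[ z < n ] 𝟙 (occ132? p x i z)

c132-remove-max : (π : Permutation′ (suc n)) (i : Fin (suc n)) → (∀ z → ¬ (π ⟨$⟩ʳ i) < (π ⟨$⟩ʳ z)) →
  c132 π ≡ c132-middle π i + c132 (remove i π)
c132-remove-max {n} π i i-max = begin
  c132 π
    ≡⟨ c132≡∑³ π ⟩
  ∑³ (λ x y z → 𝟙 (occ132? π x y z))
    ≡⟨ ∑³-remove i (λ x y z → 𝟙 (occ132? π x y z))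
         (λ y z → 𝟙-reject (λ (_ , _ , πi<πz , _) → i-max z πi<πz) (occ132? π i y z))
         (λ x y → 𝟙-reject (λ (_ , _ , _ , πi<πy) → i-max y πi<πy) (occ132? π x y i)) ⟩
  c132-middle π i + ∑³ (λ a b c → 𝟙 (occ132? π (punchIn i a) (punchIn i b) (punchIn i c)))
    ≡⟨ cong (c132-middle π i +_) (sum-cong-≗ λ a → sum-cong-≗ λ b → sum-cong-≗ λ c →
         𝟙-cong (Occ132-punchIn-⇔ π i a b c) (occ132? π _ _ _) (occ132? (remove i π) a b c)) ⟩
  c132-middle π i + ∑³ (λ a b c → 𝟙 (occ132? (remove i π) a b c))
    ≡⟨ cong (c132-middle π i +_) (c132≡∑³ (remove i π)) ⟨
  c132-middle π i + c132 (remove i π) ∎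
  where open ≡-Reasoning

4*c132-middle≤n*n : (π : Permutation′ (suc n)) (i : Fin (suc n)) → 4 * c132-middle π i ≤ n * n
4*c132-middle≤n*n {n} π i = begin
  4 * c132-middle π i
    ≤⟨ *-monoʳ-≤ 4 (∑-mono-≤ λ x → ∑-mono-≤ λ z → occ⇒x<i<z x z) ⟩
  4 * ∑[ x < suc n ] ∑[ z < suc n ] (below x * above z)
    ≡⟨ cong (4 *_) (sum-*-sum below above) ⟨
  4 * (sum below * sum above)
    ≤⟨ 4[m*n]≤[m+n]*[m+n] (sum below) (sum above) ⟩
  (sum below + sum above) * (sum below + sum above)
    ≤⟨ *-mono-≤ (∑-below+∑-above-≤ i) (∑-below+∑-above-≤ i) ⟩
  n * n ∎
  where
  open ≤-Reasoning
  below above : Fin (suc n) → ℕ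
  below x = 𝟙 (x <? i)
  above z = 𝟙 (i <? z)
  occ⇒x<i<z : ∀ x z → 𝟙 (occ132? π x i z) ≤ below x * above z
  occ⇒x<i<z x z = ≤-trans
    (𝟙-mono (λ (x<i , i<z , _) → x<i , i<z) (occ132? π x i z) ((x <? i) ×-dec (i <? z)))
    (≤-reflexive (𝟙-×-dec (x <? i) (i <? z)))

4*c132-≤-remove-max : (π : Permutation′ (suc n)) →
  4 * c132 π ≤ n * n + 4 * c132 (remove (π ⟨$⟩ˡ fromℕ n) π)
4*c132-≤-remove-max {n} π = begin
  4 * c132 π
    ≡⟨ cong (4 *_) (c132-remove-max π i i-max) ⟩
  4 * (c132-middle π i + c132 (remove i π))
    ≡⟨ *-distribˡ-+ 4 (c132-middle π i) (c132 (remove i π)) ⟩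
  4 * c132-middle π i + 4 * c132 (remove i π)
    ≤⟨ +-monoˡ-≤ (4 * c132 (remove i π)) (4*c132-middle≤n*n π i) ⟩
  n * n + 4 * c132 (remove i π) ∎
  where
  open ≤-Reasoning
  i : Fin (suc n)
  i = π ⟨$⟩ˡ fromℕ n
  i-max : ∀ z → ¬ (π ⟨$⟩ʳ i) < (π ⟨$⟩ʳ z)
  i-max z = subst (λ top → ¬ top < (π ⟨$⟩ʳ z)) (sym (inverseʳ π)) (fromℕ-≮ (π ⟨$⟩ʳ z))

lemma6p1 : ∀ (n : ℕ) → 1 ≤ n → ∀ (a b : ℕ) → IsM132 (suc n) a → IsM132 n b →
    16 * a ≤ 16 * b + 5 * n ^ 2
lemma6p1 n _ a b ((π , refl) , _) (_ , b-max) = begin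
  16 * c132 π
    ≡⟨ *-assoc 4 4 (c132 π) ⟩
  4 * (4 * c132 π)
    ≤⟨ *-monoʳ-≤ 4 (4*c132-≤-remove-max π) ⟩
  4 * (n * n + 4 * c132 π′)
    ≤⟨ *-monoʳ-≤ 4 (+-monoʳ-≤ (n * n) (*-monoʳ-≤ 4 (b-max π′))) ⟩
  4 * (n * n + 4 * b)
    ≤⟨ m≤m+n _ (n * n) ⟩
  4 * (n * n + 4 * b) + n * n
    ≡⟨ regroup n b ⟩
  16 * b + 5 * (n * n)
    ≡⟨ cong (λ m → 16 * b + 5 * (n * m)) (*-identityʳ n) ⟨
  16 * b + 5 * n ^ 2 ∎
  where
  open ≤-Reasoning
  π′ : Permutation′ n
  π′ = remove (π ⟨$⟩ˡ fromℕ n) π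
  regroup : ∀ n b → 4 * (n * n + 4 * b) + n * n ≡ 16 * b + 5 * (n * n)
  regroup = solve-∀
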